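{- For every integer $n\ge 2$, \[p_F(2,n)=\frac12\left(\sum_{\substack{1\le r\le n-1\\ \gcd(r,n)=1}}\mathrm{dep}\left(\frac rn\right)-\varphi(n)\right),\] where $\varphi$ is Euler's totient function. Moreover, $p_F(2,n)=p(2,n)$ if and only if $n$ is prime or $n=4$.
   Context: A partition of $n$ into two different parts is $(n_1^{k_1},n_2^{k_2})$ with integers $n_1>n_2\ge1$, $k_1,k_2\ge1$, $k_1n_1+k_2n_2=n$ (meaning $k_1$ parts equal to $n_1$ and $k_2$ parts equal to $n_2$); $p(2,n)$ is the number of such partitions. Let $\Phi_0=\begin{pmatrix}0&1\\1&1\end{pmatrix}$, $\Phi_1=\begin{pmatrix}1&0\\1&1\end{pmatrix}$. The Farey map is $F(x)=(1-x)/x$ on $[1/2,1]$ and $F(x)=x/(1-x)$ on $[0,1/2]$. For a rational $x\in(0,1)$ let $\ell\ge0$ be least with $F^\ell(x)=1/2$; its binary sequence is $\sigma(x)=\sigma_1\cdots\sigma_\ell$ with $\sigma_j=0$ if $F^{j-1}(x)\in(1/2,1)$ and $\sigma_j=1$ if $F^{j-1}(x)\in(0,1/2)$; if $x=p/q$ in lowest terms, $(p,q)^T=\Phi_{\sigma_1}\cdots\Phi_{\sigma_\ell}(1,2)^T$. The depth is $\mathrm{dep}(x)=\ell+1$ (the level of $x$ in the Farey tree; $\mathrm{dep}(1/2)=1$). Orbit of partitions: for $1\le r<n$, $\gcd(r,n)=1$, $\sigma(r/n)=\sigma_1\cdots\sigma_\ell$, and $m=1,\dots,\ell$, write $\Phi_{\sigma_1}\cdots\Phi_{\sigma_m}=\begin{pmatrix}h_2&h_1\\k_2&k_1\end{pmatrix}$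 and $(n_2,n_1)^T=\Phi_{\sigma_{m+1}}\cdots\Phi_{\sigma_\ell}(1,2)^T$; then $(n_1^{k_1},n_2^{k_2})$ is a partition of $n$ into two different parts, and these for $m=1,\dots,\ell$ form the orbit of partitions generated by $r/n$. $p_F(2,n)$ denotes the number of partitions of $n$ into two different parts that belong to the orbit generated by some such $r/n$. -}

module Defs where

open import Data.Nat using (ℕ; zero; suc; _+_; _*_; _∸_; _<ᵇ_; _<?_; _≟_)
open import Data.Nat.Coprimality using (coprime?)
open import Data.List using (List; []; _∷_; length; map; take; drop; applyUpTo; filter; concatMap)
open import Data.List.Membership.DecPropositional using (_∈?_)
open import Data.Product using (_×_; _,_)
import Data.Product.Properties as ×P
open import Data.Nat.ListAction using (sum)
open import Data.Bool using (if_then_else_)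
open import Relation.Nullary.Decidable using (_×-dec_)
open import Relation.Binary using (DecidableEquality)

-- Binary digits of the Farey coding: b0 ↔ σ=0, b1 ↔ σ=1
data Bit : Set where
  b0 b1 : Bit

-- σ(p/q) for 0<p<q coprime, computed with fuel (fuel = q suffices since the
-- denominator strictly decreases at each Farey step).
sigmaF : ℕ → ℕ → ℕ → List Bit
sigmaF zero    p q = []
sigmaF (suc f) p q =
  if q <ᵇ 2 * p then b0 ∷ sigmaF f (q ∸ p) p
  else if 2 * p <ᵇ q then b1 ∷ sigmaF f p (q ∸ p)
  else []

sigma : ℕ → ℕ → List Bit
sigma r n = sigmaF n r n

dep : ℕ → ℕ → ℕ
dep r n = suc (length (sigma r n))

-- 2x2 matrices over ℕ:  mat a b c d  =  [[a , b] , [c , d]]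
record Mat : Set where
  constructor mat
  field a b c d : ℕ

_⊗_ : Mat → Mat → Mat
mat a b c d ⊗ mat a' b' c' d' =
  mat (a * a' + b * c') (a * b' + b * d') (c * a' + d * c') (c * b' + d * d')

Φ : Bit → Mat
Φ b0 = mat 0 1 1 1
Φ b1 = mat 1 0 1 1

I₂ : Mat
I₂ = mat 1 0 0 1

prodΦ : List Bit → Mat
prodΦ []       = I₂
prodΦ (s ∷ ss) = Φ s ⊗ prodΦ ss

apply : Mat → ℕ × ℕ → ℕ × ℕ
apply (mat a b c d) (x , y) = (a * x + b * y , c * x + d * y)

-- A candidate partition (n₁^{k₁}, n₂^{k₂}) encoded as (n₁ , k₁ , n₂ , k₂)
Part : Set
Part = ℕ × ℕ × ℕ × ℕ

_≟P_ : DecidableEquality Part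
_≟P_ = ×P.≡-dec _≟_ (×P.≡-dec _≟_ (×P.≡-dec _≟_ _≟_))

orbitElem : List Bit → ℕ → Part
orbitElem σ m with prodΦ (take m σ) | apply (prodΦ (drop m σ)) (1 , 2)
... | mat h₂ h₁ k₂ k₁ | (n₂ , n₁) = (n₁ , k₁ , n₂ , k₂)

orbit : ℕ → ℕ → List Part
orbit r n = map (orbitElem (sigma r n)) (applyUpTo suc (length (sigma r n)))

oneTo : ℕ → List ℕ
oneTo k = applyUpTo suc k

coprimeResidues : ℕ → List ℕ
coprimeResidues n = filter (λ r → coprime? r n) (oneTo (n ∸ 1))

φ : ℕ → ℕ
φ n = length (filter (λ r → coprime? r n) (oneTo n))

partitions2 : ℕ → List Part
partitions2 n =
  filter (λ { (n₁ , k₁ , n₂ , k₂) → (n₂ <? n₁) ×-dec (k₁ * n₁ + k₂ * n₂ ≟ n) })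
    (concatMap (λ n₁ → concatMap (λ k₁ → concatMap (λ n₂ → map (λ k₂ → (n₁ , k₁ , n₂ , k₂))
      (oneTo n)) (oneTo n)) (oneTo n)) (oneTo n))

p2 : ℕ → ℕ
p2 n = length (partitions2 n)

allOrbits : ℕ → List Part
allOrbits n = concatMap (λ r → orbit r n) (coprimeResidues n)

pF2 : ℕ → ℕ
pF2 n = length (filter (λ π → _∈?_ _≟P_ π (allOrbits n)) (partitions2 n))

sumDep : ℕ → ℕ
sumDep n = sum (map (λ r → dep r n) (coprimeResidues n))

-- Cut a Farey word σ = σ(r/n) as σ = s ∷ ss ++ v with |ss| = m − 1.  The m-th element of the
-- orbit of r/n is ((n₁)^{k₁}, (n₂)^{k₂}), where (n₂ , n₁) is the fraction coded by v and
-- (k₂ , k₁) is the bottom row of Φ_s Φ_ss; that row does not depend on s and determines ss, and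
-- k₁ n₁ + k₂ n₂ is the denominator n of the fraction coded by σ.  So every partition in the
-- orbits occurs there exactly twice, at the words b0 ∷ ss ++ v and b1 ∷ ss ++ v, and the orbits,
-- of total length Σ (dep(r/n) − 1), list 2 p_F(2,n) partitions.
-- Conversely every reduced (n₂ , n₁) is coded by a word and, by Euclid's algorithm, every coprime
-- positive (k₂ , k₁) is such a bottom row.  For n prime both pairs of a partition are coprime,
-- so every partition lies in an orbit; for composite n = a b with a ≥ 2, b ≥ 3 the partition
-- ((b − 1)^a, 1^a) does not, since a bottom row (k , k) forces k = 1.

module Submission where

open import Defs
open import Level using (Level)
open import Function using (_∘_; flip)
open import Function.Bundles using (_⇔_; mk⇔; Equivalence)
open import Data.Bool.Base using (true; false)
open import Data.Product using (_×_; _,_; proj₁; proj₂; ∃; ∃₂)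
open import Data.Sum using (_⊎_; inj₁; inj₂)
open import Data.Nat using (ℕ; zero; suc; _+_; _*_; _∸_; _≤_; _<_; _<ᵇ_; _≟_; z≤n; s≤s; >-nonZero; n>1⇒nonTrivial; nonTrivial⇒n>1)
open import Data.Nat.Properties
open import Data.Nat.Divisibility using (_∣_; divides; hasNonTrivialDivisor; ∣-refl; ∣-trans; n∣m*n; ∣m∣n⇒∣m+n; ∣m∸n∣n⇒∣m)
open import Data.Nat.Coprimality using (Coprime; coprime?; coprime-+; 1-coprimeTo; prime⇒coprime) renaming (sym to coprime-sym)
open import Data.Nat.Primality using (Prime; Composite; prime?; ¬prime⇒composite)
open import Data.Nat.ListAction using (sum)
open import Data.Nat.ListAction.Properties using (sum-++)
open import Data.Nat.Tactic.RingSolver using (solve-∀)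
open import Data.List.Base using (List; []; _∷_; _++_; [_]; length; map; filter; concatMap; foldr; foldl; reverse; take; drop)
open import Data.List.Properties using (≡-dec; map-++; map-∘; length-++; length-map; length-applyUpTo; applyUpTo-∷ʳ; foldr-++; reverse-foldr; reverse-involutive; reverse-injective; filter-++; filter-reject; filter-all; filter-complete; ++-identityʳ)
open import Data.List.Relation.Unary.All as All using (All; []; _∷_; universal)
open import Data.List.Relation.Unary.All.Properties using (all-filter; concat⁺) renaming (map⁺ to All-map⁺)
open import Data.List.Relation.Unary.Any using (here; there)
open import Data.List.Relation.Unary.AllPairs using ([]; _∷_)
open import Data.List.Relation.Unary.Unique.Propositional using (Unique)
import Data.List.Relation.Unary.Unique.Propositional.Properties as Unique
open import Data.List.Membership.Propositional using (_∈_; _∉_; find; lose)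
open import Data.List.Membership.Propositional.Properties using (∈-map⁺; ∈-map⁻; ∈-concatMap⁺; ∈-concatMap⁻; ∈-filter⁺; ∈-filter⁻; ∈-applyUpTo⁺; ∈-applyUpTo⁻)
open import Data.List.Membership.DecPropositional using (_∈?_)
open import Relation.Nullary using (¬_; Dec; yes; no; contradiction)
open import Relation.Unary using (Pred; Decidable)
open import Relation.Binary using (DecidableEquality; Tri; tri<; tri≈; tri>)
open import Relation.Binary.PropositionalEquality using (_≡_; _≢_; refl; sym; trans; cong; cong₂; subst; subst₂; module ≡-Reasoning)
open import Algebra.Properties.CommutativeSemigroup +-commutativeSemigroup using (interchange)

open ≡-Reasoning

private
  variable
    ℓ ℓ′ : Level
    A B : Set ℓ
    a b k m n x y : ℕ

indicator : {P : Set ℓ} → Dec P → ℕ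
indicator (yes _) = 1
indicator (no _)  = 0

indicator-yes : {P : Set ℓ} (P? : Dec P) → P → indicator P? ≡ 1
indicator-yes (yes _) _ = refl
indicator-yes (no ¬p) p = contradiction p ¬p

indicator-no : {P : Set ℓ} (P? : Dec P) → ¬ P → indicator P? ≡ 0
indicator-no (yes p) ¬p = contradiction p ¬p
indicator-no (no _)  _  = refl

indicator-cong : {P : Set ℓ} {Q : Set ℓ′} → (P → Q) → (Q → P) →
                 (P? : Dec P) (Q? : Dec Q) → indicator P? ≡ indicator Q?
indicator-cong f g (yes p) Q? = sym (indicator-yes Q? (f p))
indicator-cong f g (no ¬p) Q? = sym (indicator-no Q? (¬p ∘ g))

∑ : List A → (A → ℕ) → ℕ
∑ xs f = sum (map f xs)

syntax ∑ xs (λ x → e) = ∑[ x ∈ xs ] e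

∑-cong : (xs : List A) {f g : A → ℕ} → (∀ {x} → x ∈ xs → f x ≡ g x) → ∑ xs f ≡ ∑ xs g
∑-cong []       eq = refl
∑-cong (x ∷ xs) eq = cong₂ _+_ (eq (here refl)) (∑-cong xs (eq ∘ there))

∑-zero : (xs : List A) {f : A → ℕ} → (∀ {x} → x ∈ xs → f x ≡ 0) → ∑ xs f ≡ 0
∑-zero []       eq = refl
∑-zero (x ∷ xs) eq = cong₂ _+_ (eq (here refl)) (∑-zero xs (eq ∘ there))

∑-const-1 : (xs : List A) → ∑[ x ∈ xs ] 1 ≡ length xs
∑-const-1 []       = refl
∑-const-1 (x ∷ xs) = cong suc (∑-const-1 xs)

∑-+ : (xs : List A) (f g : A → ℕ) → ∑[ x ∈ xs ] (f x + g x) ≡ ∑ xs f + ∑ xs g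
∑-+ []       f g = refl
∑-+ (x ∷ xs) f g = trans (cong (f x + g x +_) (∑-+ xs f g)) (interchange (f x) (g x) _ _)

∑-*ˡ : ∀ k (xs : List A) (f : A → ℕ) → ∑[ x ∈ xs ] (k * f x) ≡ k * ∑ xs f
∑-*ˡ k []       f = sym (*-zeroʳ k)
∑-*ˡ k (x ∷ xs) f = trans (cong (k * f x +_) (∑-*ˡ k xs f)) (sym (*-distribˡ-+ k (f x) _))

∑-map : (f : A → B) (xs : List A) (g : B → ℕ) → ∑ (map f xs) g ≡ ∑[ x ∈ xs ] g (f x)
∑-map f xs g = cong sum (sym (map-∘ xs))

∑-concatMap : (f : A → List B) (xs : List A) (g : B → ℕ) →
              ∑ (concatMap f xs) g ≡ ∑[ x ∈ xs ] ∑ (f x) g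
∑-concatMap f []       g = refl
∑-concatMap f (x ∷ xs) g = begin
  sum (map g (f x ++ concatMap f xs))        ≡⟨ cong sum (map-++ g (f x) _) ⟩
  sum (map g (f x) ++ map g (concatMap f xs)) ≡⟨ sum-++ (map g (f x)) _ ⟩
  ∑ (f x) g + ∑ (concatMap f xs) g           ≡⟨ cong (∑ (f x) g +_) (∑-concatMap f xs g) ⟩
  ∑ (f x) g + ∑[ x ∈ xs ] ∑ (f x) g          ∎

length-concatMap : (f : A → List B) (xs : List A) → length (concatMap f xs) ≡ ∑[ x ∈ xs ] length (f x)
length-concatMap f []       = refl
length-concatMap f (x ∷ xs) = trans (length-++ (f x)) (cong (length (f x) +_) (length-concatMap f xs))

length-filter≡∑ : {P : Pred A ℓ} (P? : Decidable P) (xs : List A) →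
                  length (filter P? xs) ≡ ∑[ x ∈ xs ] indicator (P? x)
length-filter≡∑ P? []       = refl
length-filter≡∑ P? (x ∷ xs) with P? x
... | yes _ = cong suc (length-filter≡∑ P? xs)
... | no  _ = length-filter≡∑ P? xs

length-filter≡length⇔All : {P : Pred A ℓ} (P? : Decidable P) (xs : List A) →
                           length (filter P? xs) ≡ length xs ⇔ All P xs
length-filter≡length⇔All P? xs = mk⇔
  (λ eq → subst (All _) (filter-complete P? eq) (all-filter P? xs))
  (λ all → cong length (filter-all P? all))

module _ {A : Set ℓ} (_≟ᴬ_ : DecidableEquality A) where

  occurrences : A → List A → ℕ
  occurrences x ys = ∑[ y ∈ ys ] indicator (x ≟ᴬ y)

  occurrences-∉ : ∀ {x} ys → x ∉ ys → occurrences x ys ≡ 0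
  occurrences-∉ ys x∉ys = ∑-zero ys λ y∈ys → indicator-no _ λ { refl → x∉ys y∈ys }

  ∑-indicator-unique : ∀ {y} xs → Unique xs → y ∈ xs → ∑[ x ∈ xs ] indicator (x ≟ᴬ y) ≡ 1
  ∑-indicator-unique (x ∷ xs) (x∉xs ∷ _) (here refl) =
    cong₂ _+_ (indicator-yes (x ≟ᴬ x) refl)
              (∑-zero xs λ z∈xs → indicator-no _ λ z≡x → All.lookup x∉xs z∈xs (sym z≡x))
  ∑-indicator-unique (x ∷ xs) (x∉xs ∷ u) (there y∈xs) =
    cong₂ _+_ (indicator-no _ (All.lookup x∉xs y∈xs)) (∑-indicator-unique xs u y∈xs)

  length≡∑-occurrences : ∀ {P} L → Unique P → All (_∈ P) L → length L ≡ ∑[ x ∈ P ] occurrences x L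
  length≡∑-occurrences {P} []      _  _           = sym (∑-zero P λ _ → refl)
  length≡∑-occurrences {P} (y ∷ L) uP (y∈P ∷ L⊆P) = sym (begin
    ∑[ x ∈ P ] (indicator (x ≟ᴬ y) + occurrences x L)         ≡⟨ ∑-+ P _ _ ⟩
    ∑[ x ∈ P ] indicator (x ≟ᴬ y) + ∑[ x ∈ P ] occurrences x L ≡⟨ cong₂ _+_ (∑-indicator-unique P uP y∈P)
                                                                           (sym (length≡∑-occurrences L uP L⊆P)) ⟩
    suc (length L)                                             ∎)

  open import Data.List.Membership.DecPropositional _≟ᴬ_ using () renaming (_∈?_ to _∈ᴬ?_)

  length≡*-length-filter : ∀ k {P L} → Unique P → All (_∈ P) L →
                           (∀ {x} → x ∈ L → occurrences x L ≡ k) →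
                           length L ≡ k * length (filter (_∈ᴬ? L) P)
  length≡*-length-filter k {P} {L} uP L⊆P multiplicity = begin
    length L                                ≡⟨ length≡∑-occurrences L uP L⊆P ⟩
    ∑[ x ∈ P ] occurrences x L              ≡⟨ ∑-cong P (λ {x} _ → occurrences≡ x) ⟩
    ∑[ x ∈ P ] (k * indicator (x ∈ᴬ? L))    ≡⟨ ∑-*ˡ k P _ ⟩
    k * ∑[ x ∈ P ] indicator (x ∈ᴬ? L)      ≡⟨ cong (k *_) (length-filter≡∑ (_∈ᴬ? L) P) ⟨
    k * length (filter (_∈ᴬ? L) P)          ∎
    where
    occurrences≡ : ∀ x → occurrences x L ≡ k * indicator (x ∈ᴬ? L)
    occurrences≡ x with x ∈ᴬ? L
    ... | yes x∈L = trans (multiplicity x∈L) (sym (*-identityʳ k))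
    ... | no  x∉L = trans (occurrences-∉ L x∉L) (sym (*-zeroʳ k))

Unique-concatMap : {f : A → List B} (key : B → A) {xs : List A} → Unique xs →
                   (∀ x → Unique (f x)) → (∀ x → All (λ y → key y ≡ x) (f x)) →
                   Unique (concatMap f xs)
Unique-concatMap key {[]} _ _ _ = []
Unique-concatMap {f = f} key {x ∷ xs} (x∉xs ∷ u) uf keyed =
  Unique.++⁺ (uf x) (Unique-concatMap key u uf keyed) disjoint
  where
  disjoint : ∀ {y} → ¬ (y ∈ f x × y ∈ concatMap f xs)
  disjoint (y∈fx , y∈rest) with find (∈-concatMap⁻ f {xs = xs} y∈rest)
  ... | x′ , x′∈xs , y∈fx′ =
    All.lookup x∉xs x′∈xs (trans (sym (All.lookup (keyed x) y∈fx)) (All.lookup (keyed x′) y∈fx′))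

All-map : {P : Pred B ℓ} {f : A → B} → (∀ x → P (f x)) → ∀ xs → All P (map f xs)
All-map h xs = All-map⁺ (universal h xs)

All-concatMap : {P : Pred B ℓ} {f : A → List B} → (∀ x → All P (f x)) → ∀ xs → All P (concatMap f xs)
All-concatMap h xs = concat⁺ (All-map⁺ (universal h xs))

∈-oneTo⁺ : 0 < x → x ≤ k → x ∈ oneTo k
∈-oneTo⁺ {suc i} _ i<k = ∈-applyUpTo⁺ suc i<k

∈-oneTo⁻ : x ∈ oneTo k → 0 < x × x ≤ k
∈-oneTo⁻ x∈ with ∈-applyUpTo⁻ suc x∈
... | _ , i<k , refl = s≤s z≤n , i<k

oneTo-unique : ∀ k → Unique (oneTo k)
oneTo-unique k = Unique.applyUpTo⁺₁ suc k (λ i<j _ → <⇒≢ i<j ∘ suc-injective)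

-- The Farey coding of reduced fractions

colStep : Bit → ℕ × ℕ → ℕ × ℕ
colStep b0 (p , q) = (q , p + q)
colStep b1 (p , q) = (p , p + q)

fraction : List Bit → ℕ × ℕ
fraction = foldr colStep (1 , 2)

record Reduced (p q : ℕ) : Set where
  field
    positive : 0 < p
    proper   : p < q
    coprime  : Coprime p q

coprime-∸ : ∀ {p q} → p ≤ q → Coprime p q → Coprime p (q ∸ p)
coprime-∸ p≤q c (d∣p , d∣q∸p) = c (d∣p , ∣m∸n∣n⇒∣m _ p≤q d∣q∸p d∣p)

reduced-fraction : ∀ w → Reduced (proj₁ (fraction w)) (proj₂ (fraction w))
reduced-fraction []       = record { positive = s≤s z≤n ; proper = s≤s (s≤s z≤n) ; coprime = 1-coprimeTo 2 }
reduced-fraction (b0 ∷ w) = record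
  { positive = <-trans positive proper
  ; proper   = m<n+m _ positive
  ; coprime  = coprime-sym (subst (λ s → Coprime s q) (+-comm q p) (coprime-+ coprime))
  }
  where
  p = proj₁ (fraction w)
  q = proj₂ (fraction w)
  open Reduced (reduced-fraction w)
reduced-fraction (b1 ∷ w) = record
  { positive = positive
  ; proper   = m<m+n _ (<-trans positive proper)
  ; coprime  = coprime-sym (coprime-+ (coprime-sym coprime))
  }
  where open Reduced (reduced-fraction w)

length<denominator : ∀ w → length w < proj₂ (fraction w)
length<denominator []       = s≤s z≤n
length<denominator (b0 ∷ w) = +-mono-≤ (Reduced.positive (reduced-fraction w)) (length<denominator w)
length<denominator (b1 ∷ w) = +-mono-≤ (Reduced.positive (reduced-fraction w)) (length<denominator w)

2*m≡m+m : ∀ m → 2 * m ≡ m + m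
2*m≡m+m m = cong (m +_) (+-identityʳ m)

m<n⇒m+n<2n : m < n → m + n < 2 * n
m<n⇒m+n<2n {m} {n} m<n = subst (m + n <_) (sym (2*m≡m+m n)) (+-monoˡ-< n m<n)

m<n⇒2m<m+n : m < n → 2 * m < m + n
m<n⇒2m<m+n {m} {n} m<n = subst (_< m + n) (sym (2*m≡m+m m)) (+-monoʳ-< m m<n)

m<2n⇒m∸n<n : n ≤ m → m < 2 * n → m ∸ n < n
m<2n⇒m∸n<n {n} {m} n≤m m<2n =
  +-cancelʳ-< n (m ∸ n) n (subst₂ _<_ (sym (m∸n+n≡m n≤m)) (2*m≡m+m n) m<2n)

2m<n⇒m<n∸m : 2 * m < n → m < n ∸ m
2m<n⇒m<n∸m {m} {n} 2m<n =
  +-cancelˡ-< m m (n ∸ m) (subst₂ _<_ (2*m≡m+m m) (sym (m+[n∸m]≡n m≤n)) 2m<n)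
  where m≤n = <⇒≤ (≤-<-trans (m≤m+n m (m + 0)) 2m<n)

reduced-farey₀ : ∀ {p q} → Reduced p q → q < 2 * p → Reduced (q ∸ p) p
reduced-farey₀ r q<2p = record
  { positive = m<n⇒0<n∸m proper
  ; proper   = m<2n⇒m∸n<n (<⇒≤ proper) q<2p
  ; coprime  = coprime-sym (coprime-∸ (<⇒≤ proper) coprime)
  }
  where open Reduced r

reduced-farey₁ : ∀ {p q} → Reduced p q → 2 * p < q → Reduced p (q ∸ p)
reduced-farey₁ r 2p<q = record
  { positive = positive
  ; proper   = 2m<n⇒m<n∸m 2p<q
  ; coprime  = coprime-∸ (<⇒≤ proper) coprime
  }
  where open Reduced r

sigmaF-farey₀ : ∀ {q p f} → q < 2 * p → sigmaF (suc f) p q ≡ b0 ∷ sigmaF f (q ∸ p) p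
sigmaF-farey₀ {q} {p} q<2p with q <ᵇ 2 * p | <⇒<ᵇ q<2p
... | true  | _ = refl
... | false | ()

sigmaF-farey₁ : ∀ {p q f} → 2 * p < q → sigmaF (suc f) p q ≡ b1 ∷ sigmaF f p (q ∸ p)
sigmaF-farey₁ {p} {q} 2p<q with q <ᵇ 2 * p | <ᵇ⇒< q (2 * p) | 2 * p <ᵇ q | <⇒<ᵇ 2p<q
... | true  | q<2p | _     | _  = contradiction (q<2p _) (<⇒≯ 2p<q)
... | false | _    | true  | _  = refl
... | false | _    | false | ()

sigmaF-half : ∀ {p f} → sigmaF (suc f) p (2 * p) ≡ []
sigmaF-half {p} with 2 * p <ᵇ 2 * p | <ᵇ⇒< (2 * p) (2 * p)
... | true  | 2p<2p = contradiction (2p<2p _) (<-irrefl refl)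
... | false | _     = refl

sigmaF-fraction : ∀ w {f} → length w < f → sigmaF f (proj₁ (fraction w)) (proj₂ (fraction w)) ≡ w
sigmaF-fraction []       {suc f} _           = refl
sigmaF-fraction (b0 ∷ w) {suc f} (s≤s |w|<f) = begin
  sigmaF (suc f) q (p + q)     ≡⟨ sigmaF-farey₀ {f = f} (m<n⇒m+n<2n proper) ⟩
  b0 ∷ sigmaF f (p + q ∸ q) q  ≡⟨ cong (λ x → b0 ∷ sigmaF f x q) (m+n∸n≡m p q) ⟩
  b0 ∷ sigmaF f p q            ≡⟨ cong (b0 ∷_) (sigmaF-fraction w |w|<f) ⟩
  b0 ∷ w                       ∎
  where
  p = proj₁ (fraction w)
  q = proj₂ (fraction w)
  open Reduced (reduced-fraction w)
sigmaF-fraction (b1 ∷ w) {suc f} (s≤s |w|<f) = begin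
  sigmaF (suc f) p (p + q)     ≡⟨ sigmaF-farey₁ {f = f} (m<n⇒2m<m+n proper) ⟩
  b1 ∷ sigmaF f p (p + q ∸ p)  ≡⟨ cong (λ x → b1 ∷ sigmaF f p x) (m+n∸m≡n p q) ⟩
  b1 ∷ sigmaF f p q            ≡⟨ cong (b1 ∷_) (sigmaF-fraction w |w|<f) ⟩
  b1 ∷ w                       ∎
  where
  p = proj₁ (fraction w)
  q = proj₂ (fraction w)
  open Reduced (reduced-fraction w)

fraction-sigmaF : ∀ f {p q} → Reduced p q → q ≤ f → fraction (sigmaF f p q) ≡ (p , q)
fraction-sigmaF zero r z≤n = contradiction (Reduced.proper r) λ ()
fraction-sigmaF (suc f) {p} {q} r q≤1+f with <-cmp q (2 * p)
... | tri< q<2p _ _ = begin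
  fraction (sigmaF (suc f) p q)              ≡⟨ cong fraction (sigmaF-farey₀ {f = f} q<2p) ⟩
  colStep b0 (fraction (sigmaF f (q ∸ p) p)) ≡⟨ cong (colStep b0) (fraction-sigmaF f (reduced-farey₀ r q<2p) p≤f) ⟩
  (p , q ∸ p + p)                            ≡⟨ cong (p ,_) (m∸n+n≡m (<⇒≤ proper)) ⟩
  (p , q)                                    ∎
  where
  open Reduced r
  p≤f = ≤-pred (≤-trans proper q≤1+f)
... | tri≈ _ refl _ = trans (cong fraction (sigmaF-half {p} {f}))
                            (cong (λ x → x , 2 * x) (sym (Reduced.coprime r (∣-refl , n∣m*n 2))))
... | tri> _ _ 2p<q = begin
  fraction (sigmaF (suc f) p q)              ≡⟨ cong fraction (sigmaF-farey₁ {f = f} 2p<q) ⟩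
  colStep b1 (fraction (sigmaF f p (q ∸ p))) ≡⟨ cong (colStep b1) (fraction-sigmaF f (reduced-farey₁ r 2p<q) q∸p≤f) ⟩
  (p , p + (q ∸ p))                          ≡⟨ cong (p ,_) (m+[n∸m]≡n (<⇒≤ proper)) ⟩
  (p , q)                                    ∎
  where
  open Reduced r
  q∸p≤f = ≤-trans (∸-monoʳ-≤ q positive) (∸-monoˡ-≤ 1 q≤1+f)

fraction-injective : ∀ {w w′} → fraction w ≡ fraction w′ → w ≡ w′
fraction-injective {w} {w′} eq = begin
  w
    ≡⟨ sigmaF-fraction w (length<denominator w) ⟨
  sigmaF (proj₂ (fraction w)) (proj₁ (fraction w)) (proj₂ (fraction w))
    ≡⟨ cong (λ v → sigmaF (proj₂ v) (proj₁ v) (proj₂ v)) eq ⟩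
  sigmaF (proj₂ (fraction w′)) (proj₁ (fraction w′)) (proj₂ (fraction w′))
    ≡⟨ sigmaF-fraction w′ (length<denominator w′) ⟩
  w′ ∎

-- Bottom rows of the products Φ_σ

rowStep : ℕ × ℕ → Bit → ℕ × ℕ
rowStep (x , y) b0 = (y , x + y)
rowStep (x , y) b1 = (x + y , y)

weights : List Bit → ℕ × ℕ
weights = foldl rowStep (1 , 1)

weightsʳ : List Bit → ℕ × ℕ
weightsʳ = foldr (flip rowStep) (1 , 1)

weights≡weightsʳ-reverse : ∀ ss → weights ss ≡ weightsʳ (reverse ss)
weights≡weightsʳ-reverse ss = sym (reverse-foldr (flip rowStep) (1 , 1) ss)

Positive : ℕ × ℕ → Set
Positive (x , y) = 0 < x × 0 < y

rowStep-positive : ∀ {v} s → Positive v → Positive (rowStep v s)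
rowStep-positive {x , y} b0 (0<x , 0<y) = 0<y , ≤-trans 0<y (m≤n+m y x)
rowStep-positive {x , y} b1 (0<x , 0<y) = ≤-trans 0<x (m≤m+n x y) , 0<y

rowStep-≢-diagonal : ∀ {v} s → Positive v → rowStep v s ≢ (a , a)
rowStep-≢-diagonal {v = x , y} b0 (0<x , _) eq =
  <-irrefl (trans (cong proj₁ eq) (sym (cong proj₂ eq))) (m<n+m y 0<x)
rowStep-≢-diagonal {v = x , y} b1 (0<x , _) eq =
  <-irrefl (trans (cong proj₂ eq) (sym (cong proj₁ eq))) (m<n+m y 0<x)

rowStep-injective : ∀ {v v′} s t → Positive v → Positive v′ → rowStep v s ≡ rowStep v′ t → s ≡ t × v ≡ v′
rowStep-injective {x , y} {x′ , y′} b0 b0 _ _ eq =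
  refl , cong₂ _,_ (+-cancelʳ-≡ y x x′ (trans (cong proj₂ eq) (cong (x′ +_) (sym (cong proj₁ eq))))) (cong proj₁ eq)
rowStep-injective {x , y} {x′ , y′} b1 b1 _ _ eq =
  refl , cong₂ _,_ (+-cancelʳ-≡ y x x′ (trans (cong proj₁ eq) (cong (x′ +_) (sym (cong proj₂ eq))))) (cong proj₂ eq)
rowStep-injective {x , y} {x′ , y′} b0 b1 _ (0<x′ , _) eq =
  contradiction (trans (sym (cong proj₂ eq)) (cong (x +_) (cong proj₁ eq)))
                (<⇒≢ (<-≤-trans (m<n+m y′ 0<x′) (m≤n+m (x′ + y′) x)))
rowStep-injective {x , y} {x′ , y′} b1 b0 (0<x , _) _ eq =
  contradiction (trans (cong proj₂ eq) (cong (x′ +_) (sym (cong proj₁ eq))))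
                (<⇒≢ (<-≤-trans (m<n+m y 0<x) (m≤n+m (x + y) x′)))

weightsʳ-positive : ∀ xs → Positive (weightsʳ xs)
weightsʳ-positive []       = s≤s z≤n , s≤s z≤n
weightsʳ-positive (s ∷ xs) = rowStep-positive s (weightsʳ-positive xs)

weightsʳ-injective : ∀ xs ys → weightsʳ xs ≡ weightsʳ ys → xs ≡ ys
weightsʳ-injective []       []       _  = refl
weightsʳ-injective []       (t ∷ ys) eq = contradiction (sym eq) (rowStep-≢-diagonal t (weightsʳ-positive ys))
weightsʳ-injective (s ∷ xs) []       eq = contradiction eq (rowStep-≢-diagonal s (weightsʳ-positive xs))
weightsʳ-injective (s ∷ xs) (t ∷ ys) eq
  with rowStep-injective s t (weightsʳ-positive xs) (weightsʳ-positive ys) eq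
... | refl , eq′ = cong (s ∷_) (weightsʳ-injective xs ys eq′)

weightsʳ-diagonal : ∀ xs → weightsʳ xs ≡ (a , a) → a ≡ 1
weightsʳ-diagonal []       eq = sym (cong proj₁ eq)
weightsʳ-diagonal (s ∷ xs) eq = contradiction eq (rowStep-≢-diagonal s (weightsʳ-positive xs))

-- Euclid's algorithm run backwards; the fuel f bounds a + b.
weightsʳ-surjective : ∀ f → a + b ≤ f → 0 < a → 0 < b → Coprime a b → ∃ λ xs → weightsʳ xs ≡ (a , b)
weightsʳ-surjective {suc _} zero () _ _ _
weightsʳ-surjective {a} {b} (suc f) a+b≤1+f 0<a 0<b c = step (<-cmp a b)
  where
  a≤f : a ≤ f
  a≤f = ≤-pred (≤-trans (m<m+n a 0<b) a+b≤1+f)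
  b≤f : b ≤ f
  b≤f = ≤-pred (≤-trans (m<n+m b 0<a) a+b≤1+f)
  step : Tri (a < b) (a ≡ b) (b < a) → ∃ λ xs → weightsʳ xs ≡ (a , b)
  step (tri< a<b _ _)
    with weightsʳ-surjective f (subst (_≤ f) (sym (m∸n+n≡m (<⇒≤ a<b))) b≤f)
                             (m<n⇒0<n∸m a<b) 0<a (coprime-sym (coprime-∸ (<⇒≤ a<b) c))
  ... | xs , eq = b0 ∷ xs , trans (cong (flip rowStep b0) eq) (cong (a ,_) (m∸n+n≡m (<⇒≤ a<b)))
  step (tri≈ _ a≡b _) = [] , cong₂ _,_ (sym a≡1) (sym (trans (sym a≡b) a≡1))
    where a≡1 = c (∣-refl , subst (a ∣_) a≡b ∣-refl)
  step (tri> _ _ b<a)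
    with weightsʳ-surjective f (subst (_≤ f) (sym (m∸n+n≡m (<⇒≤ b<a))) a≤f)
                             (m<n⇒0<n∸m b<a) 0<b (coprime-sym (coprime-∸ (<⇒≤ b<a) (coprime-sym c)))
  ... | xs , eq = b1 ∷ xs , trans (cong (flip rowStep b1) eq) (cong (_, b) (m∸n+n≡m (<⇒≤ b<a)))

weights-positive : ∀ ss → Positive (weights ss)
weights-positive ss = subst Positive (sym (weights≡weightsʳ-reverse ss)) (weightsʳ-positive (reverse ss))

weights-injective : ∀ {ss ss′} → weights ss ≡ weights ss′ → ss ≡ ss′
weights-injective {ss} {ss′} eq = reverse-injective (weightsʳ-injective (reverse ss) (reverse ss′)
  (trans (sym (weights≡weightsʳ-reverse ss)) (trans eq (weights≡weightsʳ-reverse ss′))))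

weights-diagonal : ∀ ss → weights ss ≡ (a , a) → a ≡ 1
weights-diagonal ss eq = weightsʳ-diagonal (reverse ss) (trans (sym (weights≡weightsʳ-reverse ss)) eq)

weights-surjective : 0 < a → 0 < b → Coprime a b → ∃ λ ss → weights ss ≡ (a , b)
weights-surjective {a} {b} 0<a 0<b c with weightsʳ-surjective (a + b) ≤-refl 0<a 0<b c
... | xs , eq = reverse xs , (begin
  weights (reverse xs)           ≡⟨ weights≡weightsʳ-reverse (reverse xs) ⟩
  weightsʳ (reverse (reverse xs)) ≡⟨ cong weightsʳ (reverse-involutive xs) ⟩
  weightsʳ xs                     ≡⟨ eq ⟩
  (a , b)                         ∎)

rowMul : ℕ × ℕ → Mat → ℕ × ℕ
rowMul (x , y) (mat a b c d) = (x * a + y * c , x * b + y * d)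

bottomRow : Mat → ℕ × ℕ
bottomRow (mat _ _ c d) = (c , d)

apply-⊗ : ∀ M N v → apply (M ⊗ N) v ≡ apply M (apply N v)
apply-⊗ (mat a b c d) (mat a′ b′ c′ d′) (x , y) =
  cong₂ _,_ (distrib a b a′ b′ c′ d′ x y) (distrib c d a′ b′ c′ d′ x y)
  where
  distrib : ∀ a b a′ b′ c′ d′ x y →
            (a * a′ + b * c′) * x + (a * b′ + b * d′) * y ≡ a * (a′ * x + b′ * y) + b * (c′ * x + d′ * y)
  distrib = solve-∀

rowMul-⊗ : ∀ v M N → rowMul v (M ⊗ N) ≡ rowMul (rowMul v M) N
rowMul-⊗ (x , y) (mat a b c d) (mat a′ b′ c′ d′) =
  cong₂ _,_ (distrib x y a b c d a′ c′) (distrib x y a b c d b′ d′)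
  where
  distrib : ∀ x y a b c d a′ c′ →
            x * (a * a′ + b * c′) + y * (c * a′ + d * c′) ≡ (x * a + y * c) * a′ + (x * b + y * d) * c′
  distrib = solve-∀

apply-Φ : ∀ s v → apply (Φ s) v ≡ colStep s v
apply-Φ b0 (x , y) = cong₂ _,_ (+-identityʳ y) (cong₂ _+_ (+-identityʳ x) (+-identityʳ y))
apply-Φ b1 (x , y) = cong₂ _,_ (trans (+-identityʳ (x + 0)) (+-identityʳ x)) (cong₂ _+_ (+-identityʳ x) (+-identityʳ y))

rowMul-Φ : ∀ v s → rowMul v (Φ s) ≡ rowStep v s
rowMul-Φ (x , y) b0 = cong₂ _,_ (cong₂ _+_ (*-zeroʳ x) (*-identityʳ y)) (cong₂ _+_ (*-identityʳ x) (*-identityʳ y))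
rowMul-Φ (x , y) b1 = cong₂ _,_ (cong₂ _+_ (*-identityʳ x) (*-identityʳ y)) (cong₂ _+_ (*-zeroʳ x) (*-identityʳ y))

apply-prodΦ : ∀ w v → apply (prodΦ w) v ≡ foldr colStep v w
apply-prodΦ []      (x , y) = cong₂ _,_ (trans (+-identityʳ (x + 0)) (+-identityʳ x)) (+-identityʳ y)
apply-prodΦ (s ∷ w) v       = begin
  apply (Φ s ⊗ prodΦ w) v        ≡⟨ apply-⊗ (Φ s) (prodΦ w) v ⟩
  apply (Φ s) (apply (prodΦ w) v) ≡⟨ apply-Φ s _ ⟩
  colStep s (apply (prodΦ w) v)   ≡⟨ cong (colStep s) (apply-prodΦ w v) ⟩
  colStep s (foldr colStep v w)   ∎

rowMul-prodΦ : ∀ v ss → rowMul v (prodΦ ss) ≡ foldl rowStep v ss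
rowMul-prodΦ (x , y) [] =
  cong₂ _,_ (trans (cong₂ _+_ (*-identityʳ x) (*-zeroʳ y)) (+-identityʳ x)) (cong₂ _+_ (*-zeroʳ x) (*-identityʳ y))
rowMul-prodΦ v (s ∷ ss) = begin
  rowMul v (Φ s ⊗ prodΦ ss)          ≡⟨ rowMul-⊗ v (Φ s) (prodΦ ss) ⟩
  rowMul (rowMul v (Φ s)) (prodΦ ss) ≡⟨ cong (λ u → rowMul u (prodΦ ss)) (rowMul-Φ v s) ⟩
  rowMul (rowStep v s) (prodΦ ss)    ≡⟨ rowMul-prodΦ (rowStep v s) ss ⟩
  foldl rowStep (rowStep v s) ss     ∎

-- Φ₀ and Φ₁ share the bottom row (1 1), so the bottom row of Φ_s Φ_ss does not depend on s.
bottomRow-prodΦ : ∀ s ss → bottomRow (prodΦ (s ∷ ss)) ≡ weights ss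
bottomRow-prodΦ b0 ss = rowMul-prodΦ (1 , 1) ss
bottomRow-prodΦ b1 ss = rowMul-prodΦ (1 , 1) ss

mkPart : ℕ × ℕ → ℕ × ℕ → Part
mkPart (n₂ , n₁) (k₂ , k₁) = (n₁ , k₁ , n₂ , k₂)

partFraction : Part → ℕ × ℕ
partFraction (n₁ , _ , n₂ , _) = (n₂ , n₁)

partWeights : Part → ℕ × ℕ
partWeights (_ , k₁ , _ , k₂) = (k₂ , k₁)

size : Part → ℕ
size (n₁ , k₁ , n₂ , k₂) = k₁ * n₁ + k₂ * n₂

orbitOf : List Bit → List Part
orbitOf w = map (orbitElem w) (oneTo (length w))

take-length-++ : ∀ (xs ys : List A) → take (length xs) (xs ++ ys) ≡ xs
take-length-++ []       ys = refl
take-length-++ (x ∷ xs) ys = cong (x ∷_) (take-length-++ xs ys)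

drop-length-++ : ∀ (xs ys : List A) → drop (length xs) (xs ++ ys) ≡ ys
drop-length-++ []       ys = refl
drop-length-++ (x ∷ xs) ys = drop-length-++ xs ys

split-at : ∀ (w : List A) {i} → i < length w → ∃ λ s → ∃₂ λ ss v → w ≡ s ∷ ss ++ v × i ≡ length ss
split-at (s ∷ w) {zero}  _           = s , [] , w , refl , refl
split-at (s ∷ w) {suc i} (s≤s i<|w|) with split-at w i<|w|
... | s′ , ss , v , refl , refl = s , s′ ∷ ss , v , refl , refl

split-index∈ : ∀ (s : Bit) ss v → suc (length ss) ∈ oneTo (length (s ∷ ss ++ v))
split-index∈ s ss v = ∈-applyUpTo⁺ suc (s≤s (subst (length ss ≤_) (sym (length-++ ss)) (m≤m+n _ _)))

orbitElem-split : ∀ s ss v → orbitElem (s ∷ ss ++ v) (suc (length ss)) ≡ mkPart (fraction v) (weights ss)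
orbitElem-split s ss v = cong₂ mkPart
  (trans (cong (λ u → apply (prodΦ u) (1 , 2)) (drop-length-++ ss v)) (apply-prodΦ v (1 , 2)))
  (trans (cong (λ u → bottomRow (prodΦ (s ∷ u))) (take-length-++ ss v)) (bottomRow-prodΦ s ss))

orbitElem-split⁻ : ∀ {w m} → m ∈ oneTo (length w) →
                   ∃ λ s → ∃₂ λ ss v → w ≡ s ∷ ss ++ v × m ≡ suc (length ss) ×
                                       orbitElem w m ≡ mkPart (fraction v) (weights ss)
orbitElem-split⁻ {w} m∈ with ∈-applyUpTo⁻ suc m∈
... | i , i<|w| , refl with split-at w i<|w|
... | s , ss , v , refl , refl = s , ss , v , refl , refl , orbitElem-split s ss v

orbitElem-injective : ∀ {w m ss v} → m ∈ oneTo (length w) → orbitElem w m ≡ mkPart (fraction v) (weights ss) →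
                      m ≡ suc (length ss) × ∃ λ s → w ≡ s ∷ ss ++ v
orbitElem-injective {w} {ss = ss} {v} m∈ eq with orbitElem-split⁻ {w} m∈
... | s , ss′ , v′ , refl , refl , eq′
  with fraction-injective {v′} {v} (cong partFraction (trans (sym eq′) eq))
     | weights-injective {ss′} {ss} (cong partWeights (trans (sym eq′) eq))
... | refl | refl = refl , s , refl

denominator-split : ∀ s ss v → proj₂ (fraction (s ∷ ss ++ v)) ≡ size (mkPart (fraction v) (weights ss))
denominator-split s ss v = begin
  proj₂ (fraction (s ∷ ss ++ v))              ≡⟨ cong proj₂ (foldr-++ colStep (1 , 2) (s ∷ ss) v) ⟩
  proj₂ (foldr colStep (fraction v) (s ∷ ss)) ≡⟨ cong proj₂ (apply-prodΦ (s ∷ ss) (fraction v)) ⟨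
  proj₂ (apply (prodΦ (s ∷ ss)) (fraction v)) ≡⟨ cong (λ (k₂ , k₁) → k₂ * n₂ + k₁ * n₁) (bottomRow-prodΦ s ss) ⟩
  k₂ * n₂ + k₁ * n₁                           ≡⟨ +-comm (k₂ * n₂) (k₁ * n₁) ⟩
  k₁ * n₁ + k₂ * n₂                           ∎
  where
  n₂ = proj₁ (fraction v)
  n₁ = proj₂ (fraction v)
  k₂ = proj₁ (weights ss)
  k₁ = proj₂ (weights ss)

∈-coprimeResidues⁺ : ∀ {r n} → Reduced r n → r ∈ coprimeResidues n
∈-coprimeResidues⁺ {r} {n} red =
  ∈-filter⁺ (λ r → coprime? r n) (∈-oneTo⁺ positive (∸-monoˡ-≤ 1 proper)) coprime
  where open Reduced red

∈-coprimeResidues⁻ : ∀ {r n} → r ∈ coprimeResidues n → Reduced r n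
∈-coprimeResidues⁻ {r} {suc n} r∈ with ∈-filter⁻ (λ r → coprime? r (suc n)) {xs = oneTo n} r∈
... | r∈oneTo , c with ∈-oneTo⁻ r∈oneTo
... | 0<r , r≤n = record { positive = 0<r ; proper = s≤s r≤n ; coprime = c }

coprimeResidues-unique : ∀ n → Unique (coprimeResidues n)
coprimeResidues-unique n = Unique.filter⁺ _ (oneTo-unique (n ∸ 1))

fraction-sigma : ∀ {r n} → r ∈ coprimeResidues n → fraction (sigma r n) ≡ (r , n)
fraction-sigma r∈ = fraction-sigmaF _ (∈-coprimeResidues⁻ r∈) ≤-refl

sigma-fraction : ∀ {n} w → proj₂ (fraction w) ≡ n → sigma (proj₁ (fraction w)) n ≡ w
sigma-fraction w refl = sigmaF-fraction w (length<denominator w)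

numerator∈coprimeResidues : ∀ {n} w → proj₂ (fraction w) ≡ n → proj₁ (fraction w) ∈ coprimeResidues n
numerator∈coprimeResidues w refl = ∈-coprimeResidues⁺ (reduced-fraction w)

infix 4 _≟ᵇ_ _≟ʷ_

_≟ᵇ_ : DecidableEquality Bit
b0 ≟ᵇ b0 = yes refl
b0 ≟ᵇ b1 = no λ ()
b1 ≟ᵇ b0 = no λ ()
b1 ≟ᵇ b1 = yes refl

_≟ʷ_ : DecidableEquality (List Bit)
_≟ʷ_ = ≡-dec _≟ᵇ_

∑-sigma-indicator : ∀ {n} w → proj₂ (fraction w) ≡ n →
                    ∑[ r ∈ coprimeResidues n ] indicator (sigma r n ≟ʷ w) ≡ 1
∑-sigma-indicator {n} w q≡n =
  trans (∑-cong (coprimeResidues n) hit)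
        (∑-indicator-unique _≟_ (coprimeResidues n) (coprimeResidues-unique n) (numerator∈coprimeResidues w q≡n))
  where
  hit : ∀ {r} → r ∈ coprimeResidues n → indicator (sigma r n ≟ʷ w) ≡ indicator (r ≟ proj₁ (fraction w))
  hit r∈ = indicator-cong
    (λ σ≡w → trans (cong proj₁ (sym (fraction-sigma {n = n} r∈))) (cong (proj₁ ∘ fraction) σ≡w))
    (λ { refl → sigma-fraction w q≡n }) _ _

-- Each partition in the orbits occurs there exactly twice

occurrences-orbitOf-split : ∀ s ss v →
  occurrences _≟P_ (mkPart (fraction v) (weights ss)) (orbitOf (s ∷ ss ++ v)) ≡ 1
occurrences-orbitOf-split s ss v = begin
  occurrences _≟P_ π (orbitOf w)                             ≡⟨ ∑-map (orbitElem w) (oneTo (length w)) _ ⟩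
  ∑[ m ∈ oneTo (length w) ] indicator (π ≟P orbitElem w m)  ≡⟨ ∑-cong (oneTo (length w)) hit ⟩
  ∑[ m ∈ oneTo (length w) ] indicator (m ≟ suc (length ss)) ≡⟨ ∑-indicator-unique _≟_ _ (oneTo-unique _) (split-index∈ s ss v) ⟩
  1                                                          ∎
  where
  w = s ∷ ss ++ v
  π = mkPart (fraction v) (weights ss)
  hit : ∀ {m} → m ∈ oneTo (length w) → indicator (π ≟P orbitElem w m) ≡ indicator (m ≟ suc (length ss))
  hit m∈ = indicator-cong (λ π≡ → proj₁ (orbitElem-injective {ss = ss} {v} m∈ (sym π≡)))
                          (λ { refl → sym (orbitElem-split s ss v) }) _ _

occurrences-orbitOf-other : ∀ w ss v → (∀ s → w ≢ s ∷ ss ++ v) →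
  occurrences _≟P_ (mkPart (fraction v) (weights ss)) (orbitOf w) ≡ 0
occurrences-orbitOf-other w ss v w≢ = occurrences-∉ _≟P_ (orbitOf w) π∉
  where
  π∉ : mkPart (fraction v) (weights ss) ∉ orbitOf w
  π∉ π∈ with ∈-map⁻ (orbitElem w) π∈
  ... | m , m∈ , π≡ with orbitElem-injective {ss = ss} {v} m∈ (sym π≡)
  ... | _ , s , w≡ = w≢ s w≡

occurrences-orbitOf : ∀ w ss v → occurrences _≟P_ (mkPart (fraction v) (weights ss)) (orbitOf w)
                                 ≡ indicator (w ≟ʷ b0 ∷ ss ++ v) + indicator (w ≟ʷ b1 ∷ ss ++ v)
occurrences-orbitOf w ss v with w ≟ʷ b0 ∷ ss ++ v | w ≟ʷ b1 ∷ ss ++ v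
... | yes refl | yes ()
... | yes refl | no _     = occurrences-orbitOf-split b0 ss v
... | no _     | yes refl = occurrences-orbitOf-split b1 ss v
... | no w≢₀   | no w≢₁   = occurrences-orbitOf-other w ss v λ { b0 → w≢₀ ; b1 → w≢₁ }

∈-allOrbits⁺ : ∀ {n} ss v → size (mkPart (fraction v) (weights ss)) ≡ n →
               mkPart (fraction v) (weights ss) ∈ allOrbits n
∈-allOrbits⁺ {n} ss v size≡n =
  ∈-concatMap⁺ (λ r → orbit r n) (lose (numerator∈coprimeResidues w q≡n) π∈orbit)
  where
  w = b0 ∷ ss ++ v
  q≡n = trans (denominator-split b0 ss v) size≡n
  π∈orbit : mkPart (fraction v) (weights ss) ∈ orbitOf (sigma (proj₁ (fraction w)) n)
  π∈orbit = subst (λ u → _ ∈ orbitOf u) (sym (sigma-fraction w q≡n))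
                  (subst (_∈ orbitOf w) (orbitElem-split b0 ss v) (∈-map⁺ (orbitElem w) (split-index∈ b0 ss v)))

∈-allOrbits⁻ : ∀ {n π} → π ∈ allOrbits n → ∃₂ λ ss v → π ≡ mkPart (fraction v) (weights ss) × size π ≡ n
∈-allOrbits⁻ {n} π∈ with find (∈-concatMap⁻ (λ r → orbit r n) {xs = coprimeResidues n} π∈)
... | r , r∈ , π∈orbit with ∈-map⁻ (orbitElem (sigma r n)) π∈orbit
... | m , m∈ , refl with orbitElem-split⁻ {sigma r n} m∈
... | s , ss , v , σ≡ , _ , elem≡ = ss , v , elem≡ , (begin
  size (orbitElem (sigma r n) m)            ≡⟨ cong size elem≡ ⟩
  size (mkPart (fraction v) (weights ss))   ≡⟨ denominator-split s ss v ⟨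
  proj₂ (fraction (s ∷ ss ++ v))            ≡⟨ cong (proj₂ ∘ fraction) σ≡ ⟨
  proj₂ (fraction (sigma r n))              ≡⟨ cong proj₂ (fraction-sigma r∈) ⟩
  n                                         ∎)

occurrences-allOrbits : ∀ {n} ss v → size (mkPart (fraction v) (weights ss)) ≡ n →
                        occurrences _≟P_ (mkPart (fraction v) (weights ss)) (allOrbits n) ≡ 2
occurrences-allOrbits {n} ss v size≡n = begin
  occurrences _≟P_ π (allOrbits n)
    ≡⟨ ∑-concatMap (λ r → orbit r n) (coprimeResidues n) _ ⟩
  ∑[ r ∈ coprimeResidues n ] occurrences _≟P_ π (orbit r n)
    ≡⟨ ∑-cong (coprimeResidues n) (λ {r} _ → occurrences-orbitOf (sigma r n) ss v) ⟩
  ∑[ r ∈ coprimeResidues n ] (indicator (sigma r n ≟ʷ w₀) + indicator (sigma r n ≟ʷ w₁))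
    ≡⟨ ∑-+ (coprimeResidues n) _ _ ⟩
  ∑[ r ∈ coprimeResidues n ] indicator (sigma r n ≟ʷ w₀) + ∑[ r ∈ coprimeResidues n ] indicator (sigma r n ≟ʷ w₁)
    ≡⟨ cong₂ _+_ (∑-sigma-indicator w₀ (trans (denominator-split b0 ss v) size≡n))
                 (∑-sigma-indicator w₁ (trans (denominator-split b1 ss v) size≡n)) ⟩
  2 ∎
  where
  π = mkPart (fraction v) (weights ss)
  w₀ = b0 ∷ ss ++ v
  w₁ = b1 ∷ ss ++ v

IsPartition : ℕ → Part → Set
IsPartition n (n₁ , k₁ , n₂ , k₂) = 0 < n₂ × n₂ < n₁ × 0 < k₁ × 0 < k₂ × k₁ * n₁ + k₂ * n₂ ≡ n

candidates : ℕ → List Part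
candidates n = concatMap (λ n₁ → concatMap (λ k₁ → concatMap (λ n₂ → map (λ k₂ → (n₁ , k₁ , n₂ , k₂))
  (oneTo n)) (oneTo n)) (oneTo n)) (oneTo n)

∈-candidates⁺ : ∀ {n n₁ k₁ n₂ k₂} → n₁ ∈ oneTo n → k₁ ∈ oneTo n → n₂ ∈ oneTo n → k₂ ∈ oneTo n →
                (n₁ , k₁ , n₂ , k₂) ∈ candidates n
∈-candidates⁺ n₁∈ k₁∈ n₂∈ k₂∈ =
  ∈-concatMap⁺ _ (lose n₁∈ (∈-concatMap⁺ _ (lose k₁∈ (∈-concatMap⁺ _ (lose n₂∈ (∈-map⁺ _ k₂∈))))))

∈-candidates⁻ : ∀ {n n₁ k₁ n₂ k₂} → (n₁ , k₁ , n₂ , k₂) ∈ candidates n →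
                n₁ ∈ oneTo n × k₁ ∈ oneTo n × n₂ ∈ oneTo n × k₂ ∈ oneTo n
∈-candidates⁻ {n} π∈ with find (∈-concatMap⁻ _ {xs = oneTo n} π∈)
... | _ , n₁∈ , π∈₁ with find (∈-concatMap⁻ _ {xs = oneTo n} π∈₁)
... | _ , k₁∈ , π∈₂ with find (∈-concatMap⁻ _ {xs = oneTo n} π∈₂)
... | _ , n₂∈ , π∈₃ with ∈-map⁻ _ π∈₃
... | _ , k₂∈ , refl = n₁∈ , k₁∈ , n₂∈ , k₂∈

candidates-unique : ∀ n → Unique (candidates n)
candidates-unique n =
  Unique-concatMap proj₁ oneTo! (λ n₁ →
    Unique-concatMap (proj₁ ∘ proj₂) oneTo! (λ k₁ →
      Unique-concatMap (proj₁ ∘ proj₂ ∘ proj₂) oneTo!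
        (λ n₂ → Unique.map⁺ (cong (proj₂ ∘ proj₂ ∘ proj₂)) oneTo!)
        (λ n₂ → All-map (λ _ → refl) R))
      (λ k₁ → All-concatMap (λ n₂ → All-map (λ _ → refl) R) R))
    (λ n₁ → All-concatMap (λ k₁ → All-concatMap (λ n₂ → All-map (λ _ → refl) R) R) R)
  where
  R = oneTo n
  oneTo! = oneTo-unique n

partitions2-unique : ∀ n → Unique (partitions2 n)
partitions2-unique n = Unique.filter⁺ _ (candidates-unique n)

∈-partitions2⁺ : ∀ {n π} → IsPartition n π → π ∈ partitions2 n
∈-partitions2⁺ {n} {n₁ , k₁ , n₂ , k₂} (0<n₂ , n₂<n₁ , 0<k₁ , 0<k₂ , sum≡n) =
  ∈-filter⁺ _ (∈-candidates⁺ {n} (proj₂ big) (proj₁ big) (proj₂ small) (proj₁ small)) (n₂<n₁ , sum≡n)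
  where
  factors∈ : ∀ {k m r} → 0 < k → 0 < m → k * m ≤ r → k ∈ oneTo r × m ∈ oneTo r
  factors∈ {k} {m} 0<k 0<m km≤r =
    ∈-oneTo⁺ 0<k (≤-trans (m≤m*n k m {{>-nonZero 0<m}}) km≤r) ,
    ∈-oneTo⁺ 0<m (≤-trans (m≤n*m m k {{>-nonZero 0<k}}) km≤r)
  big : k₁ ∈ oneTo n × n₁ ∈ oneTo n
  big = factors∈ 0<k₁ (<-trans 0<n₂ n₂<n₁) (subst (k₁ * n₁ ≤_) sum≡n (m≤m+n _ _))
  small : k₂ ∈ oneTo n × n₂ ∈ oneTo n
  small = factors∈ 0<k₂ 0<n₂ (subst (k₂ * n₂ ≤_) sum≡n (m≤n+m _ _))

∈-partitions2⁻ : ∀ {n π} → π ∈ partitions2 n → IsPartition n π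
∈-partitions2⁻ {n} π∈ with ∈-filter⁻ _ {xs = candidates n} π∈
... | π∈candidates , n₂<n₁ , sum≡n with ∈-candidates⁻ {n} π∈candidates
... | _ , k₁∈ , n₂∈ , k₂∈ = proj₁ (∈-oneTo⁻ n₂∈) , n₂<n₁ , proj₁ (∈-oneTo⁻ k₁∈) , proj₁ (∈-oneTo⁻ k₂∈) , sum≡n

∈-allOrbits⇒IsPartition : ∀ {n π} → π ∈ allOrbits n → IsPartition n π
∈-allOrbits⇒IsPartition π∈ with ∈-allOrbits⁻ π∈
... | ss , v , refl , size≡n = positive , proper , proj₂ (weights-positive ss) , proj₁ (weights-positive ss) , size≡n
  where open Reduced (reduced-fraction v)

-- The depth identity

2*pF2≡length-allOrbits : ∀ n → 2 * pF2 n ≡ length (allOrbits n)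
2*pF2≡length-allOrbits n =
  sym (length≡*-length-filter _≟P_ 2 (partitions2-unique n)
         (All.tabulate (∈-partitions2⁺ ∘ ∈-allOrbits⇒IsPartition {n})) multiplicity)
  where
  multiplicity : ∀ {π} → π ∈ allOrbits n → occurrences _≟P_ π (allOrbits n) ≡ 2
  multiplicity π∈ with ∈-allOrbits⁻ {n} π∈
  ... | ss , v , refl , size≡n = occurrences-allOrbits ss v size≡n

length-allOrbits : ∀ n → length (allOrbits n) ≡ ∑[ r ∈ coprimeResidues n ] length (sigma r n)
length-allOrbits n = trans (length-concatMap (λ r → orbit r n) (coprimeResidues n))
  (∑-cong (coprimeResidues n) λ {r} _ → trans (length-map _ (oneTo (length (sigma r n)))) (length-applyUpTo suc _))

sumDep≡length+∑-length-sigma : ∀ n →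
  sumDep n ≡ length (coprimeResidues n) + ∑[ r ∈ coprimeResidues n ] length (sigma r n)
sumDep≡length+∑-length-sigma n =
  trans (∑-+ (coprimeResidues n) (λ _ → 1) (λ r → length (sigma r n)))
        (cong (_+ ∑[ r ∈ coprimeResidues n ] length (sigma r n)) (∑-const-1 (coprimeResidues n)))

φ≡length-coprimeResidues : 2 ≤ n → φ n ≡ length (coprimeResidues n)
φ≡length-coprimeResidues {suc n} (s≤s 1≤n) = begin
  length (filter cop (oneTo (suc n)))                ≡⟨ cong (length ∘ filter cop) (applyUpTo-∷ʳ suc n) ⟨
  length (filter cop (oneTo n ++ [ suc n ]))         ≡⟨ cong length (filter-++ cop (oneTo n) [ suc n ]) ⟩
  length (filter cop (oneTo n) ++ filter cop [ suc n ]) ≡⟨ cong (λ xs → length (filter cop (oneTo n) ++ xs))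
                                                                (filter-reject cop ¬coprime-self) ⟩
  length (filter cop (oneTo n) ++ [])                ≡⟨ cong length (++-identityʳ (filter cop (oneTo n))) ⟩
  length (filter cop (oneTo n))                      ∎
  where
  cop = λ r → coprime? r (suc n)
  ¬coprime-self : ¬ Coprime (suc n) (suc n)
  ¬coprime-self c = <⇒≢ (s≤s 1≤n) (sym (c (∣-refl , ∣-refl)))

-- When every partition lies in an orbit

factor<sum : 0 < x → 0 < y → 0 < b → x * a + y * b ≡ n → a < n
factor<sum {x} {y} {b} {a} 0<x 0<y 0<b refl =
  ≤-<-trans (m≤n*m a x {{>-nonZero 0<x}}) (m<m+n (x * a) (*-mono-≤ 0<y 0<b))

prime-sum⇒coprime : Prime n → 0 < a → a < n → x * a + y * b ≡ n → Coprime a b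
prime-sum⇒coprime {n} {a} {x} {y} {b} pr 0<a a<n sum≡n {d} (d∣a , d∣b) =
  prime⇒coprime pr {{>-nonZero 0<a}} a<n (subst (d ∣_) sum≡n d∣sum , d∣a)
  where d∣sum = ∣m∣n⇒∣m+n (∣-trans d∣a (n∣m*n x)) (∣-trans d∣b (n∣m*n y))

prime⇒∈-allOrbits : Prime n → ∀ {π} → IsPartition n π → π ∈ allOrbits n
prime⇒∈-allOrbits {n} pr {n₁ , k₁ , n₂ , k₂} (0<n₂ , n₂<n₁ , 0<k₁ , 0<k₂ , sum≡n) =
  subst (_∈ allOrbits n) (cong₂ mkPart fraction≡ weights≡) (∈-allOrbits⁺ ss v size≡n)
  where
  0<n₁ = <-trans 0<n₂ n₂<n₁
  sum≡n′ = trans (cong₂ _+_ (*-comm n₁ k₁) (*-comm n₂ k₂)) sum≡n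
  n₁<n = factor<sum {a = n₁} 0<k₁ 0<k₂ 0<n₂ sum≡n
  k₁<n = factor<sum {a = k₁} 0<n₁ 0<n₂ 0<k₂ sum≡n′
  reduced : Reduced n₂ n₁
  reduced = record { positive = 0<n₂ ; proper = n₂<n₁
                   ; coprime = coprime-sym (prime-sum⇒coprime {x = k₁} {k₂} pr 0<n₁ n₁<n sum≡n) }
  v = sigma n₂ n₁
  fraction≡ : fraction v ≡ (n₂ , n₁)
  fraction≡ = fraction-sigmaF n₁ reduced ≤-refl
  weightsOf : ∃ λ ss → weights ss ≡ (k₂ , k₁)
  weightsOf = weights-surjective 0<k₂ 0<k₁ (coprime-sym (prime-sum⇒coprime {x = n₁} {n₂} pr 0<k₁ k₁<n sum≡n′))
  ss = proj₁ weightsOf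
  weights≡ = proj₂ weightsOf
  size≡n : size (mkPart (fraction v) (weights ss)) ≡ n
  size≡n = trans (cong₂ (λ f w → size (mkPart f w)) fraction≡ weights≡) sum≡n

orbit-weights-diagonal : ∀ {n n₁ n₂ k} → (n₁ , k , n₂ , k) ∈ allOrbits n → k ≡ 1
orbit-weights-diagonal {n} π∈ with ∈-allOrbits⁻ {n} π∈
... | ss , v , π≡ , _ = weights-diagonal ss (sym (cong partWeights π≡))

composite⇒factors : Composite n → n ≢ 4 → ∃₂ λ a b → 2 ≤ a × 3 ≤ b × a * b ≡ n
composite⇒factors {n} (hasNonTrivialDivisor {d} {{nt}} d<n (divides q n≡qd)) n≢4 =
  factorise q d (nonTrivial⇒n>1 d {{nt}}) d<n n≡qd
  where
  factorise : ∀ q d → 1 < d → d < n → n ≡ q * d → ∃₂ λ a b → 2 ≤ a × 3 ≤ b × a * b ≡ n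
  factorise 0 d _ d<n n≡0 = contradiction (subst (d <_) n≡0 d<n) λ ()
  factorise 1 d _ d<n n≡d = contradiction (trans n≡d (+-identityʳ d)) (>⇒≢ d<n)
  factorise 2 (suc zero) (s≤s ()) _ _
  factorise 2 (suc (suc zero)) _ _ n≡4 = contradiction n≡4 n≢4
  factorise 2 (suc (suc (suc d))) _ _ n≡2d = 2 , 3 + d , ≤-refl , s≤s (s≤s (s≤s z≤n)) , sym n≡2d
  factorise (suc (suc (suc q))) d 1<d _ n≡qd = d , 3 + q , 1<d , s≤s (s≤s (s≤s z≤n)) , trans (*-comm d _) (sym n≡qd)

-- For n = a b with a ≥ 2 and b ≥ 3, the partition ((b − 1)^a, 1^a) has k₁ = k₂ = a ≠ 1.
composite⇒partition∉allOrbits : 2 ≤ a → 3 ≤ b → a * b ≡ n → ∃ λ π → π ∈ partitions2 n × π ∉ allOrbits n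
composite⇒partition∉allOrbits {a} {suc (suc (suc c))} {n} 2≤a (s≤s (s≤s (s≤s _))) ab≡n =
  (2 + c , a , 1 , a) , ∈-partitions2⁺ (s≤s z≤n , s≤s (s≤s z≤n) , 0<a , 0<a , sum≡n) ,
  λ π∈ → <⇒≢ 2≤a (sym (orbit-weights-diagonal {n} π∈))
  where
  0<a = <-trans (s≤s z≤n) 2≤a
  sum≡n = trans (sym (*-distribˡ-+ a (2 + c) 1)) (trans (cong (a *_) (+-comm (2 + c) 1)) ab≡n)

pF2≡p2⇔prime⊎4 : 2 ≤ n → (pF2 n ≡ p2 n) ⇔ (Prime n ⊎ n ≡ 4)
pF2≡p2⇔prime⊎4 {n} 2≤n = mk⇔ to from
  where
  complete⇔ = length-filter≡length⇔All (λ π → _∈?_ _≟P_ π (allOrbits n)) (partitions2 n)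
  to : pF2 n ≡ p2 n → Prime n ⊎ n ≡ 4
  to eq with prime? n | n ≟ 4
  ... | yes pr | _        = inj₁ pr
  ... | no _   | yes n≡4  = inj₂ n≡4
  ... | no ¬pr | no n≢4
    with composite⇒factors (¬prime⇒composite {{n>1⇒nonTrivial 2≤n}} ¬pr) n≢4
  ...   | a , b , 2≤a , 3≤b , ab≡n with composite⇒partition∉allOrbits 2≤a 3≤b ab≡n
  ...     | π , π∈P , π∉L = contradiction (All.lookup (Equivalence.to complete⇔ eq) π∈P) π∉L
  from : Prime n ⊎ n ≡ 4 → pF2 n ≡ p2 n
  from (inj₁ pr)   = Equivalence.from complete⇔ (All.tabulate (prime⇒∈-allOrbits pr ∘ ∈-partitions2⁻))
  from (inj₂ refl) = refl  -- both sides evaluate to 2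

corollary4p5 : (n : ℕ) → 2 ≤ n →
    (2 * pF2 n + φ n ≡ sumDep n) × ((pF2 n ≡ p2 n) ⇔ (Prime n ⊎ n ≡ 4))
corollary4p5 n 2≤n = depthIdentity , pF2≡p2⇔prime⊎4 2≤n
  where
  depthIdentity : 2 * pF2 n + φ n ≡ sumDep n
  depthIdentity = begin
    2 * pF2 n + φ n
      ≡⟨ cong₂ _+_ (2*pF2≡length-allOrbits n) (φ≡length-coprimeResidues 2≤n) ⟩
    length (allOrbits n) + length (coprimeResidues n)
      ≡⟨ cong (_+ length (coprimeResidues n)) (length-allOrbits n) ⟩
    ∑[ r ∈ coprimeResidues n ] length (sigma r n) + length (coprimeResidues n)
      ≡⟨ +-comm _ (length (coprimeResidues n)) ⟩
    length (coprimeResidues n) + ∑[ r ∈ coprimeResidues n ] length (sigma r n)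
      ≡⟨ sumDep≡length+∑-length-sigma n ⟨
    sumDep n ∎
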